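{- Let $D$ be a digraph with $n$ vertices and $n$ arcs, and let $f$ be a super edge-magic labeling of $D$. Let $h:E(D)\to\mathcal{S}_p^k$ be any function. Then there exists $\bar h:E(D)\to\mathcal{S}_p^{p+3-k}$ such that $\overline{\widehat{e(f)}}\simeq\widehat{o(f_c)}$, where $\overline{\widehat{e(f)}}$ is the complementary labeling of the labeling of $D\otimes_h\mathcal{S}_p^k$ induced by $e(f)$, and $\widehat{o(f_c)}$ is the labeling of $D\otimes_{\bar h}\mathcal{S}_p^{p+3-k}$ induced by $o(f_c)$.
   Context: Digraphs may have loops but no multiple arcs. $[a,b]=\{a,\dots,b\}$. An edge-magic labeling of a $(p,q)$-(di)graph $G$ is a bijection $f:V(G)\cup E(G)\to[1,p+q]$ with $f(x)+f(xy)+f(y)=\mathrm{val}(f)$ constant over edges; super if $f(V(G))=[1,p]$. Complementary labeling: $\overline f(x)=p+q+1-f(x)$. The super edge-magic complementary labeling $f_c$ of a super edge-magic labeling $f$ of a $(p,q)$-graph is $f_c(x)=p+1-f(x)$ on vertices and $f_c(xy)=2p+q+1-f(xy)$ on edges. For a super edge-magic labeling $f$ of an $(n,n)$-(di)graph, the odd and even labelings are $o(f)(x)=2f(x)-1$, $e(f)(x)=2f(x)$ on vertices and $o(f)(xy)=2\mathrm{val}(f)-2n-2-o(f)(x)-o(f)(y)$, $e(f)(xy)=2\mathrm{val}(f)-2n-1-e(f)(x)-e(f)(y)$ on edges; both are edge-magic labelings. $\mathcal{S}_p^k$: the set of digraphs $F$ with vertex set $[1,p]$, exactly $p$ arcs,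 and $\{i+j:(i,j)\in E(F)\}=[k,k+p-1]$. For $h$ from $E(D)$ to a family of digraphs with common vertex set $V$, $D\otimes_h\Gamma$ has vertex set $V(D)\times V$ and arcs $((a,i),(b,j))$ with $(a,b)\in E(D)$, $(i,j)\in E(h(a,b))$. For an edge-magic labeling $g$ of $D$ and $h:E(D)\to\mathcal{S}_p^k$, the induced labeling $\hat g$ of $D\otimes_h\mathcal{S}_p^k$ is $\hat g(a,i)=p(g(a)-1)+i$, $\hat g((a,i),(b,j))=p(g((a,b))-1)+k+p-(i+j)$. $\simeq$ means there is a digraph isomorphism carrying one labeling to the other. -}

module Defs where

open import Data.Nat using (ℕ; zero; suc; _+_; _*_; _∸_; _≤_; _<_)
open import Data.Fin using (Fin; toℕ)
open import Data.Product using (Σ; ∃; _×_; _,_; proj₁; proj₂)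
open import Data.Sum using (_⊎_; inj₁; inj₂)
open import Function using (_∘_; _⇔_; _↔_; Injective; Inverse)
open import Relation.Binary.PropositionalEquality using (_≡_)

-- Digraphs with vertex set Fin p (|V| = p) and arcs indexed by Fin q
-- (|E| = q).  Loops are allowed; "no multiple arcs" is injectivity of
-- the endpoint map.

record Digraph (p q : ℕ) : Set where
  field
    arc     : Fin q → Fin p × Fin p
    arc-inj : Injective _≡_ _≡_ arc

  src tgt : Fin q → Fin p
  src = proj₁ ∘ arc
  tgt = proj₂ ∘ arc

open Digraph public

Labeling : ℕ → ℕ → Set
Labeling p q = Fin p ⊎ Fin q → ℕ

arcSum : ∀ {p q} → Digraph p q → Labeling p q → Fin q → ℕ
arcSum D f e = f (inj₁ (src D e)) + f (inj₂ e) + f (inj₁ (tgt D e))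

IsBijLabeling : ∀ {p q} → Labeling p q → Set
IsBijLabeling {p} {q} f =
  Injective _≡_ _≡_ f
  × (∀ x → 1 ≤ f x × f x ≤ p + q)
  × (∀ m → 1 ≤ m → m ≤ p + q → ∃ λ x → f x ≡ m)

IsEdgeMagic : ∀ {p q} → Digraph p q → Labeling p q → Set
IsEdgeMagic D f = IsBijLabeling f × ∃ λ c → ∀ e → arcSum D f e ≡ c

IsSuperEdgeMagic : ∀ {p q} → Digraph p q → Labeling p q → Set
IsSuperEdgeMagic {p} D f =
  IsEdgeMagic D f
  × (∀ v → f (inj₁ v) ≤ p)
  × (∀ m → 1 ≤ m → m ≤ p → ∃ λ v → f (inj₁ v) ≡ m)

-- val(f): the magic constant (read off at the first arc; irrelevant
-- when there are no arcs)
val : ∀ {p q} → Digraph p q → Labeling p q → ℕ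
val {q = zero}  D f = 0
val {q = suc q} D f = arcSum D f Fin.zero
  where import Data.Fin as Fin

compl : (p q : ℕ) → ∀ {V E : Set} → (V ⊎ E → ℕ) → (V ⊎ E → ℕ)
compl p q f x = p + q + 1 ∸ f x

secompl : ∀ {p q} → Labeling p q → Labeling p q
secompl {p} {q} f (inj₁ v) = p + 1 ∸ f (inj₁ v)
secompl {p} {q} f (inj₂ e) = 2 * p + q + 1 ∸ f (inj₂ e)

oddL : ∀ {n} → Digraph n n → Labeling n n → Labeling n n
oddL D f (inj₁ v) = 2 * f (inj₁ v) ∸ 1
oddL {n} D f (inj₂ e) =
  2 * val D f ∸ 2 * n ∸ 2 ∸ oddL D f (inj₁ (src D e)) ∸ oddL D f (inj₁ (tgt D e))

evenL : ∀ {n} → Digraph n n → Labeling n n → Labeling n n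
evenL D f (inj₁ v) = 2 * f (inj₁ v)
evenL {n} D f (inj₂ e) =
  2 * val D f ∸ 2 * n ∸ 1 ∸ evenL D f (inj₁ (src D e)) ∸ evenL D f (inj₁ (tgt D e))

-- The family S_p^k.  Vertex i : Fin p stands for the vertex toℕ i + 1
-- of [1,p].

vnum : ∀ {p} → Fin p → ℕ
vnum i = suc (toℕ i)

arcNum : ∀ {p} → Digraph p p → Fin p → ℕ
arcNum F t = vnum (src F t) + vnum (tgt F t)

InS : (p k : ℕ) → Digraph p p → Set
InS p k F = ∀ s → (k ≤ s × s < k + p) ⇔ (∃ λ t → arcNum F t ≡ s)

S : (p k : ℕ) → Set
S p k = Σ (Digraph p p) (InS p k)

record Graph (V E : Set) : Set where
  field
    gsrc gtgt : E → V
open Graph public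

prodG : ∀ {n q p k} → Digraph n q → (Fin q → S p k)
      → Graph (Fin n × Fin p) (Fin q × Fin p)
gsrc (prodG D h) (e , t) = src D e , src (proj₁ (h e)) t
gtgt (prodG D h) (e , t) = tgt D e , tgt (proj₁ (h e)) t

induced : ∀ {n q p k} → Digraph n q → (Fin q → S p k) → Labeling n q
        → ((Fin n × Fin p) ⊎ (Fin q × Fin p) → ℕ)
induced {p = p} D h g (inj₁ (a , i)) = p * (g (inj₁ a) ∸ 1) + vnum i
induced {p = p} {k} D h g (inj₂ (e , t)) =
  p * (g (inj₂ e) ∸ 1) + k + p ∸ arcNum (proj₁ (h e)) t

record LabIso {V₁ E₁ V₂ E₂ : Set} (G₁ : Graph V₁ E₁) (G₂ : Graph V₂ E₂)
              (l₁ : V₁ ⊎ E₁ → ℕ) (l₂ : V₂ ⊎ E₂ → ℕ) : Set where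
  field
    φV : V₁ ↔ V₂
    φE : E₁ ↔ E₂
    src-pres : ∀ e → gsrc G₂ (Inverse.to φE e) ≡ Inverse.to φV (gsrc G₁ e)
    tgt-pres : ∀ e → gtgt G₂ (Inverse.to φE e) ≡ Inverse.to φV (gtgt G₁ e)
    labV : ∀ v → l₂ (inj₁ (Inverse.to φV v)) ≡ l₁ (inj₁ v)
    labE : ∀ e → l₂ (inj₂ (Inverse.to φE e)) ≡ l₁ (inj₂ e)

-- Reflecting every factor digraph through i ↦ p + 1 − i turns an arc sum s into 2p + 2 − s,
-- so it maps S_p^k onto S_p^(p+3−k).  A label of D ⊗_h S_p^k induced by g has the form
-- p(G − 1) + c with block G = g(x) and offset c ∈ [1, p]; its complement with respect to
-- (n + q)p + 1 is p((n + q + 1 − G) − 1) + (p + 1 − c), the label induced by the complementary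
-- labeling of g on the product with the reflected factors, under (a, i) ↦ (a, p + 1 − i).
-- For a super edge-magic f the complement of e(f) is exactly o(f_c) (vertices 2n + 1 − 2f(v),
-- arcs 4n + 2 − 2f(e)), and the corollary is the case g = e(f).

module Submission where

open import Data.Empty using (⊥-elim)
open import Data.Fin using (Fin; toℕ; opposite)
import Data.Fin as Fin
open import Data.Fin.Properties using (toℕ<n; opposite-prop; opposite-involutive)
open import Data.List using ([]; _∷_)
open import Data.Nat using (ℕ; zero; suc; _+_; _*_; _∸_; _≤_; _<_; s≤s; z≤n)
open import Data.Nat.Properties
open import Algebra.Properties.CommutativeSemigroup +-commutativeSemigroup using (interchange; x∙yz≈y∙xz)
open import Data.Nat.Tactic.RingSolver using (solve)
open import Data.Product using (Σ; ∃; _×_; _,_; proj₁; proj₂; map₂)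
open import Data.Product.Properties using (,-injectiveˡ; ,-injectiveʳ)
open import Data.Sum using (_⊎_; inj₁; inj₂)
open import Function using (_∘_; _↔_; Equivalence; mk⇔; mk↔ₛ′)
open import Function.Construct.Identity using (↔-id)
open import Relation.Binary.PropositionalEquality
open import Relation.Nullary using (yes; no)

open import Defs

m+n≡o⇒o∸m≡n : ∀ m {n o} → m + n ≡ o → o ∸ m ≡ n
m+n≡o⇒o∸m≡n m {n} refl = m+n∸m≡n m n

∸-+-assoc₄ : ∀ x a b c d → x ∸ a ∸ b ∸ c ∸ d ≡ x ∸ (a + b + c + d)
∸-+-assoc₄ x a b c d = begin
  x ∸ a ∸ b ∸ c ∸ d         ≡⟨ cong (λ y → y ∸ c ∸ d) (∸-+-assoc x a b) ⟩
  x ∸ (a + b) ∸ c ∸ d       ≡⟨ cong (_∸ d) (∸-+-assoc x (a + b) c) ⟩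
  x ∸ (a + b + c) ∸ d       ≡⟨ ∸-+-assoc x (a + b + c) d ⟩
  x ∸ (a + b + c + d)       ∎
  where open ≡-Reasoning

-- Reflection of the factor digraphs

opposite-injective : ∀ {p} {i j : Fin p} → opposite i ≡ opposite j → i ≡ j
opposite-injective {i = i} {j} eq =
  trans (sym (opposite-involutive i)) (trans (cong opposite eq) (opposite-involutive j))

vnum-opposite : ∀ {p} (i : Fin p) → vnum (opposite i) + vnum i ≡ suc p
vnum-opposite {p} i = begin
  suc (toℕ (opposite i)) + suc (toℕ i) ≡⟨ cong (λ x → suc x + suc (toℕ i)) (opposite-prop i) ⟩
  suc (p ∸ suc (toℕ i)) + suc (toℕ i) ≡⟨ cong suc (m∸n+n≡m (toℕ<n i)) ⟩
  suc p                               ∎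
  where open ≡-Reasoning

reverse : ∀ {p} → Digraph p p → Digraph p p
reverse F = record
  { arc     = λ t → opposite (src F t) , opposite (tgt F t)
  ; arc-inj = λ eq → arc-inj F (cong₂ _,_ (opposite-injective (,-injectiveˡ eq))
                                          (opposite-injective (,-injectiveʳ eq)))
  }

arcNum-reverse : ∀ {p} (F : Digraph p p) t → arcNum (reverse F) t + arcNum F t ≡ p + p + 2
arcNum-reverse {p} F t = begin
  (vnum (opposite i) + vnum (opposite j)) + (vnum i + vnum j)
    ≡⟨ interchange (vnum (opposite i)) (vnum (opposite j)) (vnum i) (vnum j) ⟩
  (vnum (opposite i) + vnum i) + (vnum (opposite j) + vnum j)
    ≡⟨ cong₂ _+_ (vnum-opposite i) (vnum-opposite j) ⟩
  suc p + suc p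
    ≡⟨ solve (p ∷ []) ⟩
  p + p + 2
    ∎
  where
  open ≡-Reasoning
  i j : Fin p
  i = src F t
  j = tgt F t

arcNum≤ : ∀ {p} (F : Digraph p p) t → arcNum F t ≤ p + p
arcNum≤ F t = +-mono-≤ (toℕ<n (src F t)) (toℕ<n (tgt F t))

-- The vertex only witnesses p ≢ 0.
InS-start≤ : ∀ {p k F} → InS p k F → Fin p → k ≤ p + 1
InS-start≤ {suc p} {k} {F} inS _ = +-cancelʳ-≤ p k (suc p + 1) (begin
  k + p                ≡⟨ sym (proj₂ top) ⟩
  arcNum F (proj₁ top) ≤⟨ arcNum≤ F (proj₁ top) ⟩
  suc p + suc p        ≡⟨ solve (p ∷ []) ⟩
  suc p + 1 + p        ∎)
  where
  open ≤-Reasoning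
  top : ∃ λ t → arcNum F t ≡ k + p
  top = Equivalence.to (inS (k + p)) (m≤m+n k p , +-monoʳ-< k (n<1+n p))

InS-start≤p+3 : ∀ {p k F} → InS p k F → Fin p → k ≤ p + 3
InS-start≤p+3 {p} {F = F} inS i = ≤-trans (InS-start≤ {F = F} inS i) (+-monoʳ-≤ p (s≤s z≤n))

window-reflect : ∀ {p k k′ s s′} → k + k′ ≡ p + 3 → s + s′ ≡ p + p + 2
               → k ≤ s × s < k + p → k′ ≤ s′ × s′ < k′ + p
window-reflect {p} {k} {k′} {s} {s′} k+k′ s+s′ (k≤s , s<k+p) =
  +-cancelˡ-≤ s k′ s′ (≤-pred (begin
    suc (s + k′)   ≤⟨ +-monoˡ-≤ k′ s<k+p ⟩
    k + p + k′     ≡⟨ solve (k ∷ p ∷ k′ ∷ []) ⟩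
    k + k′ + p     ≡⟨ cong (_+ p) k+k′ ⟩
    p + 3 + p      ≡⟨ solve (p ∷ []) ⟩
    suc (p + p + 2) ≡⟨ cong suc (sym s+s′) ⟩
    suc (s + s′)   ∎))
  , +-cancelˡ-< k s′ (k′ + p) (begin-strict
    k + s′         ≤⟨ +-monoˡ-≤ s′ k≤s ⟩
    s + s′         ≡⟨ s+s′ ⟩
    p + p + 2      <⟨ n<1+n _ ⟩
    suc (p + p + 2) ≡⟨ solve (p ∷ []) ⟩
    p + 3 + p      ≡⟨ cong (_+ p) (sym k+k′) ⟩
    k + k′ + p     ≡⟨ +-assoc k k′ p ⟩
    k + (k′ + p)   ∎)
  where open ≤-Reasoning

InS-reverse : ∀ {p k} {F : Digraph p p} → InS p k F → InS p (p + 3 ∸ k) (reverse F)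
InS-reverse {zero} inS s =
  mk⇔ (λ (k′≤s , s<k′+0) → ⊥-elim (n≮n _ (≤-<-trans k′≤s (subst (s <_) (+-identityʳ _) s<k′+0))))
      (λ { (() , _) })
InS-reverse {suc p} {k} {F} inS s = mk⇔ to from
  where
  k′ : ℕ
  k′ = suc p + 3 ∸ k
  k+k′ : k + k′ ≡ suc p + 3
  k+k′ = m+[n∸m]≡n (InS-start≤p+3 {F = F} inS Fin.zero)
  from : (∃ λ t → arcNum (reverse F) t ≡ s) → k′ ≤ s × s < k′ + suc p
  from (t , refl) = window-reflect k+k′ (trans (+-comm (arcNum F t) _) (arcNum-reverse F t))
                                    (Equivalence.from (inS _) (t , refl))
  to : k′ ≤ s × s < k′ + suc p → ∃ λ t → arcNum (reverse F) t ≡ s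
  to window = reflect-back (Equivalence.to (inS s′) (window-reflect (trans (+-comm k′ k) k+k′) s+s′ window))
    where
    s′ : ℕ
    s′ = suc p + suc p + 2 ∸ s
    s+s′ : s + s′ ≡ suc p + suc p + 2
    s+s′ = m+[n∸m]≡n (≤-pred (begin
      suc s                   ≤⟨ proj₂ window ⟩
      k′ + suc p              ≤⟨ +-monoˡ-≤ (suc p) (m∸n≤m (suc p + 3) k) ⟩
      suc p + 3 + suc p       ≡⟨ solve (p ∷ []) ⟩
      suc (suc p + suc p + 2) ∎))
      where open ≤-Reasoning
    reflect-back : (∃ λ t → arcNum F t ≡ s′) → ∃ λ t → arcNum (reverse F) t ≡ s
    reflect-back (t , arcNum≡s′) = t , +-cancelʳ-≡ (arcNum F t) _ _
      (trans (arcNum-reverse F t) (trans (sym s+s′) (cong (s +_) (sym arcNum≡s′))))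

reverseS : ∀ {p k} → S p k → S p (p + 3 ∸ k)
reverseS (F , inS) = reverse F , InS-reverse {F = F} inS

-- Complement of an induced labeling

complement-block : ∀ {M p G c c′} → 1 ≤ G → G ≤ M → c′ + c ≡ suc p
                 → M * p + 1 ∸ (p * (G ∸ 1) + c) ≡ p * (M ∸ G) + c′
complement-block {p = p} {suc g} {c} {c′} _ G≤M c′+c with m≤n⇒∃[o]m+o≡n G≤M
... | d , refl = begin
  (suc g + d) * p + 1 ∸ (p * g + c) ≡⟨ m+n≡o⇒o∸m≡n (p * g + c) split ⟩
  p * d + c′                         ≡⟨ cong (λ x → p * x + c′) (sym (m+n∸m≡n (suc g) d)) ⟩
  p * (suc g + d ∸ suc g) + c′       ∎
  where
  open ≡-Reasoning
  split : p * g + c + (p * d + c′) ≡ (suc g + d) * p + 1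
  split = begin
    p * g + c + (p * d + c′) ≡⟨ solve (p ∷ g ∷ d ∷ c ∷ c′ ∷ []) ⟩
    p * (g + d) + (c′ + c)   ≡⟨ cong (p * (g + d) +_) c′+c ⟩
    p * (g + d) + suc p      ≡⟨ solve (p ∷ g ∷ d ∷ []) ⟩
    (suc g + d) * p + 1      ∎

complement-shift : ∀ {M G} → G ≤ M → M + 1 ∸ G ∸ 1 ≡ M ∸ G
complement-shift {M} {G} G≤M = trans (cong (_∸ 1) (+-∸-comm 1 G≤M)) (m+n∸n≡m (M ∸ G) 1)

arc-offsets-sum : ∀ {p k s} → k ≤ s → s ≤ k + p → suc (s ∸ k) + (k + p ∸ s) ≡ suc p
arc-offsets-sum {p} {k} k≤s s≤k+p with m≤n⇒∃[o]m+o≡n k≤s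
... | a , refl = cong suc (begin
  k + a ∸ k + (k + p ∸ (k + a)) ≡⟨ cong₂ _+_ (m+n∸m≡n k a) ([m+n]∸[m+o]≡n∸o k p a) ⟩
  a + (p ∸ a)                   ≡⟨ m+[n∸m]≡n (+-cancelˡ-≤ k a p s≤k+p) ⟩
  p                             ∎)
  where open ≡-Reasoning

reversed-offset : ∀ {p k s s′} → k ≤ s → k ≤ p + 3 → s′ + s ≡ p + p + 2
                → s′ + suc (s ∸ k) ≡ (p + 3 ∸ k) + p
reversed-offset {p} {k} {s′ = s′} k≤s k≤p+3 s′+s with m≤n⇒∃[o]m+o≡n k≤s | m≤n⇒∃[o]m+o≡n k≤p+3
... | a , refl | c , k+c = begin
  s′ + suc (k + a ∸ k) ≡⟨ cong (λ x → s′ + suc x) (m+n∸m≡n k a) ⟩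
  s′ + suc a           ≡⟨ +-cancelʳ-≡ k _ _ (begin
    s′ + suc a + k       ≡⟨ solve (s′ ∷ a ∷ k ∷ []) ⟩
    suc (s′ + (k + a))   ≡⟨ cong suc s′+s ⟩
    suc (p + p + 2)      ≡⟨ solve (p ∷ []) ⟩
    p + (p + 3)          ≡⟨ cong (p +_) (sym k+c) ⟩
    p + (k + c)          ≡⟨ solve (p ∷ k ∷ c ∷ []) ⟩
    c + p + k            ∎) ⟩
  c + p                ≡⟨ cong (_+ p) (sym (m+n≡o⇒o∸m≡n k k+c)) ⟩
  p + 3 ∸ k + p        ∎
  where open ≡-Reasoning

complement-vertex : ∀ {m n p G c c′} → 1 ≤ G → G ≤ m + n → c′ + c ≡ suc p
                  → p * (m + n + 1 ∸ G ∸ 1) + c′ ≡ m * p + n * p + 1 ∸ (p * (G ∸ 1) + c)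
complement-vertex {m} {n} {p} {G} {c} {c′} 1≤G G≤M c′+c = begin
  p * (m + n + 1 ∸ G ∸ 1) + c′
    ≡⟨ cong (λ x → p * x + c′) (complement-shift G≤M) ⟩
  p * (m + n ∸ G) + c′
    ≡⟨ sym (complement-block 1≤G G≤M c′+c) ⟩
  (m + n) * p + 1 ∸ (p * (G ∸ 1) + c)
    ≡⟨ cong (λ x → x + 1 ∸ (p * (G ∸ 1) + c)) (*-distribʳ-+ p m n) ⟩
  m * p + n * p + 1 ∸ (p * (G ∸ 1) + c)
    ∎
  where open ≡-Reasoning

complement-arc : ∀ {m n p G k s s′} → 1 ≤ G → G ≤ m + n → k ≤ s × s < k + p → k ≤ p + 3
               → s′ + s ≡ p + p + 2
               → p * (m + n + 1 ∸ G ∸ 1) + (p + 3 ∸ k) + p ∸ s′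
                 ≡ m * p + n * p + 1 ∸ (p * (G ∸ 1) + k + p ∸ s)
complement-arc {m} {n} {p} {G} {k} {s} {s′} 1≤G G≤M (k≤s , s<k+p) k≤p+3 s′+s = begin
  p * (m + n + 1 ∸ G ∸ 1) + (p + 3 ∸ k) + p ∸ s′
    ≡⟨ cong (λ x → p * x + (p + 3 ∸ k) + p ∸ s′) (complement-shift G≤M) ⟩
  X + (p + 3 ∸ k) + p ∸ s′
    ≡⟨ m+n≡o⇒o∸m≡n s′ reflected ⟩
  X + suc (s ∸ k)
    ≡⟨ sym (complement-block 1≤G G≤M (arc-offsets-sum k≤s (<⇒≤ s<k+p))) ⟩
  (m + n) * p + 1 ∸ (p * (G ∸ 1) + (k + p ∸ s))
    ≡⟨ cong₂ (λ x y → x + 1 ∸ y) (*-distribʳ-+ p m n) (sym regroup) ⟩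
  m * p + n * p + 1 ∸ (p * (G ∸ 1) + k + p ∸ s)
    ∎
  where
  open ≡-Reasoning
  X : ℕ
  X = p * (m + n ∸ G)
  reflected : s′ + (X + suc (s ∸ k)) ≡ X + (p + 3 ∸ k) + p
  reflected = begin
    s′ + (X + suc (s ∸ k)) ≡⟨ x∙yz≈y∙xz s′ X _ ⟩
    X + (s′ + suc (s ∸ k)) ≡⟨ cong (X +_) (reversed-offset k≤s k≤p+3 s′+s) ⟩
    X + ((p + 3 ∸ k) + p)  ≡⟨ sym (+-assoc X _ p) ⟩
    X + (p + 3 ∸ k) + p    ∎
  regroup : p * (G ∸ 1) + k + p ∸ s ≡ p * (G ∸ 1) + (k + p ∸ s)
  regroup = trans (cong (_∸ s) (+-assoc (p * (G ∸ 1)) k p)) (+-∸-assoc (p * (G ∸ 1)) (<⇒≤ s<k+p))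

map₂-opposite-↔ : ∀ {n p} → (Fin n × Fin p) ↔ (Fin n × Fin p)
map₂-opposite-↔ = mk↔ₛ′ (map₂ opposite) (map₂ opposite) involutive involutive
  where
  involutive : ∀ x → map₂ opposite (map₂ opposite x) ≡ x
  involutive (a , i) = cong (a ,_) (opposite-involutive i)

complement-induced≃induced-complement
  : ∀ {n q p k} (D : Digraph n q) (h : Fin q → S p k) (g : Labeling n q)
  → (∀ x → 1 ≤ g x × g x ≤ n + q)
  → LabIso (prodG D h) (prodG D (reverseS ∘ h))
           (compl (n * p) (q * p) (induced D h g)) (induced D (reverseS ∘ h) (compl n q g))
complement-induced≃induced-complement {n} {q} {p} {k} D h g bounds = record
  { φV = map₂-opposite-↔
  ; φE = ↔-id _
  ; src-pres = λ _ → refl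
  ; tgt-pres = λ _ → refl
  ; labV = λ { (a , i) → vertex-label a i }
  ; labE = λ { (e , t) → arc-label e t }
  }
  where
  vertex-label : ∀ a i → induced D (reverseS ∘ h) (compl n q g) (inj₁ (a , opposite i))
                       ≡ compl (n * p) (q * p) (induced D h g) (inj₁ (a , i))
  vertex-label a i = let (1≤G , G≤n+q) = bounds (inj₁ a) in
    complement-vertex {n} {q} 1≤G G≤n+q (vnum-opposite i)
  arc-label : ∀ e t → induced D (reverseS ∘ h) (compl n q g) (inj₂ (e , t))
                    ≡ compl (n * p) (q * p) (induced D h g) (inj₂ (e , t))
  arc-label e t = let (F , inS) = h e ; (1≤G , G≤n+q) = bounds (inj₂ e) in
    complement-arc {n} {q} {s′ = arcNum (reverse F) t} 1≤G G≤n+q (Equivalence.from (inS (arcNum F t)) (t , refl))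
                   (InS-start≤p+3 {F = F} inS t) (arcNum-reverse F t)

induced-cong : ∀ {n q p k} (D : Digraph n q) (h : Fin q → S p k) {g g′ : Labeling n q}
             → g ≗ g′ → induced D h g ≗ induced D h g′
induced-cong {p = p} D h g≗g′ (inj₁ (a , i)) = cong (λ x → p * (x ∸ 1) + vnum i) (g≗g′ (inj₁ a))
induced-cong {p = p} {k} D h g≗g′ (inj₂ (e , t)) =
  cong (λ x → p * (x ∸ 1) + k + p ∸ arcNum (proj₁ (h e)) t) (g≗g′ (inj₂ e))

LabIso-resp₂ : ∀ {V₁ E₁ V₂ E₂ : Set} {G₁ : Graph V₁ E₁} {G₂ : Graph V₂ E₂}
               {l₁ : V₁ ⊎ E₁ → ℕ} {l₂ l₂′ : V₂ ⊎ E₂ → ℕ}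
             → l₂ ≗ l₂′ → LabIso G₁ G₂ l₁ l₂ → LabIso G₁ G₂ l₁ l₂′
LabIso-resp₂ l₂≗l₂′ iso = record
  { φV = φV ; φE = φE ; src-pres = src-pres ; tgt-pres = tgt-pres
  ; labV = λ v → trans (sym (l₂≗l₂′ _)) (labV v)
  ; labE = λ e → trans (sym (l₂≗l₂′ _)) (labE e)
  }
  where open LabIso iso

-- Odd and even labelings

even-arc-value : ∀ n A F B → 2 * (A + F + B) ∸ 2 * n ∸ 1 ∸ 2 * A ∸ 2 * B ≡ 2 * F ∸ (2 * n + 1)
even-arc-value n A F B = begin
  2 * (A + F + B) ∸ 2 * n ∸ 1 ∸ 2 * A ∸ 2 * B
    ≡⟨ ∸-+-assoc₄ _ (2 * n) 1 (2 * A) (2 * B) ⟩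
  2 * (A + F + B) ∸ (2 * n + 1 + 2 * A + 2 * B)
    ≡⟨ cong₂ _∸_ total removed ⟩
  (2 * A + 2 * B) + 2 * F ∸ ((2 * A + 2 * B) + (2 * n + 1))
    ≡⟨ [m+n]∸[m+o]≡n∸o (2 * A + 2 * B) (2 * F) (2 * n + 1) ⟩
  2 * F ∸ (2 * n + 1)
    ∎
  where
  open ≡-Reasoning
  total : 2 * (A + F + B) ≡ (2 * A + 2 * B) + 2 * F
  total = solve (A ∷ F ∷ B ∷ [])
  removed : 2 * n + 1 + 2 * A + 2 * B ≡ (2 * A + 2 * B) + (2 * n + 1)
  removed = solve (n ∷ A ∷ B ∷ [])

odd-arc-value : ∀ n A F B → 1 ≤ A → 1 ≤ B
              → 2 * (A + F + B) ∸ 2 * n ∸ 2 ∸ (2 * A ∸ 1) ∸ (2 * B ∸ 1) ≡ 2 * F ∸ 2 * n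
odd-arc-value n (suc a) F (suc b) _ _ = begin
  2 * (suc a + F + suc b) ∸ 2 * n ∸ 2 ∸ (2 * suc a ∸ 1) ∸ (2 * suc b ∸ 1)
    ≡⟨ ∸-+-assoc₄ _ (2 * n) 2 _ _ ⟩
  2 * (suc a + F + suc b) ∸ (2 * n + 2 + (2 * suc a ∸ 1) + (2 * suc b ∸ 1))
    ≡⟨ cong₂ _∸_ total removed ⟩
  (2 * a + 2 * b + 4) + 2 * F ∸ ((2 * a + 2 * b + 4) + 2 * n)
    ≡⟨ [m+n]∸[m+o]≡n∸o (2 * a + 2 * b + 4) (2 * F) (2 * n) ⟩
  2 * F ∸ 2 * n
    ∎
  where
  open ≡-Reasoning
  odd : ∀ x → 2 * suc x ∸ 1 ≡ 2 * x + 1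
  odd x = m+n≡o⇒o∸m≡n 1 {2 * x + 1} {2 * suc x} (solve (x ∷ []))
  total : 2 * (suc a + F + suc b) ≡ (2 * a + 2 * b + 4) + 2 * F
  total = solve (a ∷ F ∷ b ∷ [])
  removed : 2 * n + 2 + (2 * suc a ∸ 1) + (2 * suc b ∸ 1) ≡ (2 * a + 2 * b + 4) + 2 * n
  removed = begin
    2 * n + 2 + (2 * suc a ∸ 1) + (2 * suc b ∸ 1)
      ≡⟨ cong₂ (λ x y → 2 * n + 2 + x + y) (odd a) (odd b) ⟩
    2 * n + 2 + (2 * a + 1) + (2 * b + 1)
      ≡⟨ solve (n ∷ a ∷ b ∷ []) ⟩
    (2 * a + 2 * b + 4) + 2 * n
      ∎

complement-even-vertex : ∀ n A → n + n + 1 ∸ 2 * A ≡ 2 * (n + 1 ∸ A) ∸ 1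
complement-even-vertex n A = begin
  suc (n + n + 1) ∸ suc (2 * A) ≡⟨ cong₂ _∸_ doubled (+-comm 1 (2 * A)) ⟩
  2 * (n + 1) ∸ (2 * A + 1)     ≡⟨ sym (∸-+-assoc (2 * (n + 1)) (2 * A) 1) ⟩
  2 * (n + 1) ∸ 2 * A ∸ 1       ≡⟨ cong (_∸ 1) (sym (*-distribˡ-∸ 2 (n + 1) A)) ⟩
  2 * (n + 1 ∸ A) ∸ 1           ∎
  where
  open ≡-Reasoning
  doubled : suc (n + n + 1) ≡ 2 * (n + 1)
  doubled = solve (n ∷ [])

double-excess : ∀ n u → 2 * (suc n + u) ∸ (2 * n + 1) ≡ suc (2 * u)
double-excess n u = m+n≡o⇒o∸m≡n (2 * n + 1) (solve (n ∷ u ∷ []))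

complement-even-arc : ∀ {n F} → n < F
                    → n + n + 1 ∸ (2 * F ∸ (2 * n + 1)) ≡ 2 * (2 * n + n + 1 ∸ F) ∸ 2 * n
complement-even-arc {n} n<F with m≤n⇒∃[o]m+o≡n n<F
... | u , refl = begin
  n + n + 1 ∸ (2 * (suc n + u) ∸ (2 * n + 1)) ≡⟨ cong (n + n + 1 ∸_) (double-excess n u) ⟩
  n + n + 1 ∸ suc (2 * u)                     ≡⟨ cong (_∸ suc (2 * u)) (+-comm (n + n) 1) ⟩
  n + n ∸ 2 * u                               ≡⟨ cong (_∸ 2 * u) (cong (n +_) (sym (+-identityʳ n))) ⟩
  2 * n ∸ 2 * u                               ≡⟨ sym (*-distribˡ-∸ 2 n u) ⟩
  2 * (n ∸ u)                                 ≡⟨ cong (2 *_) (sym n+n∸u∸n) ⟩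
  2 * (n + n ∸ u ∸ n)                         ≡⟨ *-distribˡ-∸ 2 (n + n ∸ u) n ⟩
  2 * (n + n ∸ u) ∸ 2 * n                     ≡⟨ cong (λ x → 2 * x ∸ 2 * n) (sym secompl-label) ⟩
  2 * (2 * n + n + 1 ∸ (suc n + u)) ∸ 2 * n   ∎
  where
  open ≡-Reasoning
  secompl-label : 2 * n + n + 1 ∸ (suc n + u) ≡ n + n ∸ u
  secompl-label = trans (cong (_∸ (suc n + u)) regroup) ([m+n]∸[m+o]≡n∸o (suc n) (n + n) u)
    where
    regroup : 2 * n + n + 1 ≡ suc n + (n + n)
    regroup = solve (n ∷ [])
  n+n∸u∸n : n + n ∸ u ∸ n ≡ n ∸ u
  n+n∸u∸n = trans (∸-+-assoc (n + n) u n) (trans (cong (n + n ∸_) (+-comm u n)) ([m+n]∸[m+o]≡n∸o n n u))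

double-bounds : ∀ {n A} → 1 ≤ A → A ≤ n → 1 ≤ 2 * A × 2 * A ≤ n + n
double-bounds {A = A} 1≤A A≤n =
  ≤-trans 1≤A (m≤m+n A (A + 0)) , +-mono-≤ A≤n (≤-trans (≤-reflexive (+-identityʳ A)) A≤n)

even-arc-bounds : ∀ {n F} → n < F → F ≤ n + n
                → 1 ≤ 2 * F ∸ (2 * n + 1) × 2 * F ∸ (2 * n + 1) ≤ n + n
even-arc-bounds {n} n<F F≤n+n with m≤n⇒∃[o]m+o≡n n<F
... | u , refl rewrite double-excess n u =
  s≤s z≤n , +-mono-≤ 1+u≤n (≤-trans (≤-reflexive (+-identityʳ u)) (≤-trans (n≤1+n u) 1+u≤n))
  where
  1+u≤n : suc u ≤ n
  1+u≤n = +-cancelˡ-≤ n (suc u) n (≤-trans (≤-reflexive (+-suc n u)) F≤n+n)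

val≡arcSum : ∀ {p q} (D : Digraph p q) (g : Labeling p q) {c} → (∀ e → arcSum D g e ≡ c)
           → ∀ e → val D g ≡ arcSum D g e
val≡arcSum {q = suc q} D g magic e = trans (magic Fin.zero) (sym (magic e))

evenL-arc : ∀ {n} (D : Digraph n n) (g : Labeling n n) e → val D g ≡ arcSum D g e
          → evenL D g (inj₂ e) ≡ 2 * g (inj₂ e) ∸ (2 * n + 1)
evenL-arc {n} D g e val≡ =
  trans (cong (λ v → 2 * v ∸ 2 * n ∸ 1 ∸ 2 * g (inj₁ (src D e)) ∸ 2 * g (inj₁ (tgt D e))) val≡)
        (even-arc-value n (g (inj₁ (src D e))) (g (inj₂ e)) (g (inj₁ (tgt D e))))

oddL-arc : ∀ {n} (D : Digraph n n) (g : Labeling n n) e → val D g ≡ arcSum D g e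
         → 1 ≤ g (inj₁ (src D e)) → 1 ≤ g (inj₁ (tgt D e))
         → oddL D g (inj₂ e) ≡ 2 * g (inj₂ e) ∸ 2 * n
oddL-arc {n} D g e val≡ 1≤A 1≤B =
  trans (cong (λ v → 2 * v ∸ 2 * n ∸ 2 ∸ (2 * g (inj₁ (src D e)) ∸ 1) ∸ (2 * g (inj₁ (tgt D e)) ∸ 1)) val≡)
        (odd-arc-value n (g (inj₁ (src D e))) (g (inj₂ e)) (g (inj₁ (tgt D e))) 1≤A 1≤B)

secompl-arcSum : ∀ {p q} (D : Digraph p q) (f : Labeling p q) e
               → f (inj₁ (src D e)) ≤ p + 1 → f (inj₂ e) ≤ 2 * p + q + 1 → f (inj₁ (tgt D e)) ≤ p + 1
               → arcSum D (secompl f) e + arcSum D f e ≡ (p + 1) + (2 * p + q + 1) + (p + 1)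
secompl-arcSum {p} {q} D f e A≤ F≤ B≤ = begin
  (p + 1 ∸ A + (2 * p + q + 1 ∸ F) + (p + 1 ∸ B)) + (A + F + B)
    ≡⟨ interchange (p + 1 ∸ A + (2 * p + q + 1 ∸ F)) (p + 1 ∸ B) (A + F) B ⟩
  (p + 1 ∸ A + (2 * p + q + 1 ∸ F) + (A + F)) + (p + 1 ∸ B + B)
    ≡⟨ cong (_+ (p + 1 ∸ B + B)) (interchange (p + 1 ∸ A) (2 * p + q + 1 ∸ F) A F) ⟩
  (p + 1 ∸ A + A) + (2 * p + q + 1 ∸ F + F) + (p + 1 ∸ B + B)
    ≡⟨ cong₂ _+_ (cong₂ _+_ (m∸n+n≡m A≤) (m∸n+n≡m F≤)) (m∸n+n≡m B≤) ⟩
  (p + 1) + (2 * p + q + 1) + (p + 1) ∎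
  where
  open ≡-Reasoning
  A F B : ℕ
  A = f (inj₁ (src D e))
  F = f (inj₂ e)
  B = f (inj₁ (tgt D e))

p<arc-label : ∀ {p q} (D : Digraph p q) (f : Labeling p q) → IsSuperEdgeMagic D f
            → ∀ e → p < f (inj₂ e)
p<arc-label {p} D f (((f-inj , f-bounds , _) , _) , _ , vertex-onto) e with p <? f (inj₂ e)
... | yes p<F = p<F
... | no p≮F with vertex-onto (f (inj₂ e)) (proj₁ (f-bounds (inj₂ e))) (≮⇒≥ p≮F)
...   | v , fv≡F with f-inj fv≡F
...     | ()

module _ {n} {D : Digraph n n} {f : Labeling n n} (sem : IsSuperEdgeMagic D f) where

  private
    f-bounds : ∀ x → 1 ≤ f x × f x ≤ n + n
    f-bounds = proj₁ (proj₂ (proj₁ (proj₁ sem)))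
    c : ℕ
    c = proj₁ (proj₂ (proj₁ sem))
    magic : ∀ e → arcSum D f e ≡ c
    magic = proj₂ (proj₂ (proj₁ sem))
    vertex≤ : ∀ v → f (inj₁ v) ≤ n
    vertex≤ = proj₁ (proj₂ sem)

    secompl-magic : ∀ e → arcSum D (secompl f) e ≡ (n + 1) + (2 * n + n + 1) + (n + 1) ∸ c
    secompl-magic e = sym (m+n≡o⇒o∸m≡n c (begin
      c + arcSum D (secompl f) e
        ≡⟨ +-comm c _ ⟩
      arcSum D (secompl f) e + c
        ≡⟨ cong (arcSum D (secompl f) e +_) (sym (magic e)) ⟩
      arcSum D (secompl f) e + arcSum D f e
        ≡⟨ secompl-arcSum D f e (vertex≤n+1 (src D e)) arc≤ (vertex≤n+1 (tgt D e)) ⟩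
      (n + 1) + (2 * n + n + 1) + (n + 1)
        ∎))
      where
      open ≡-Reasoning
      vertex≤n+1 : ∀ v → f (inj₁ v) ≤ n + 1
      vertex≤n+1 v = ≤-trans (vertex≤ v) (m≤m+n n 1)
      arc≤ : f (inj₂ e) ≤ 2 * n + n + 1
      arc≤ = ≤-trans (proj₂ (f-bounds (inj₂ e))) (≤-trans (m≤m+n (n + n) (n + 1)) (≤-reflexive n+n+[n+1]≡))
        where
        n+n+[n+1]≡ : n + n + (n + 1) ≡ 2 * n + n + 1
        n+n+[n+1]≡ = solve (n ∷ [])

  evenL-bounds : ∀ x → 1 ≤ evenL D f x × evenL D f x ≤ n + n
  evenL-bounds (inj₁ v) = double-bounds (proj₁ (f-bounds (inj₁ v))) (vertex≤ v)
  evenL-bounds (inj₂ e) =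
    subst (λ y → 1 ≤ y × y ≤ n + n) (sym (evenL-arc D f e (val≡arcSum D f magic e)))
          (even-arc-bounds (p<arc-label D f sem e) (proj₂ (f-bounds (inj₂ e))))

  compl-evenL≗oddL-secompl : compl n n (evenL D f) ≗ oddL D (secompl f)
  compl-evenL≗oddL-secompl (inj₁ v) = complement-even-vertex n (f (inj₁ v))
  compl-evenL≗oddL-secompl (inj₂ e) = begin
    n + n + 1 ∸ evenL D f (inj₂ e)
      ≡⟨ cong (n + n + 1 ∸_) (evenL-arc D f e (val≡arcSum D f magic e)) ⟩
    n + n + 1 ∸ (2 * F ∸ (2 * n + 1))
      ≡⟨ complement-even-arc (p<arc-label D f sem e) ⟩
    2 * (2 * n + n + 1 ∸ F) ∸ 2 * n
      ≡⟨ sym (oddL-arc D (secompl f) e (val≡arcSum D (secompl f) secompl-magic e)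
                       (complement-positive (src D e)) (complement-positive (tgt D e))) ⟩
    oddL D (secompl f) (inj₂ e)
      ∎
    where
    open ≡-Reasoning
    F : ℕ
    F = f (inj₂ e)
    complement-positive : ∀ v → 1 ≤ n + 1 ∸ f (inj₁ v)
    complement-positive v = m<n⇒0<n∸m (≤-trans (s≤s (vertex≤ v)) (≤-reflexive (+-comm 1 n)))

corollary2p5 : (n p k : ℕ) (D : Digraph n n) (f : Labeling n n)
    → IsSuperEdgeMagic D f
    → (h : Fin n → S p k)
    → Σ (Fin n → S p (p + 3 ∸ k)) (λ h̄ →
        LabIso (prodG D h) (prodG D h̄)
          (compl (n * p) (n * p) (induced D h (evenL D f)))
          (induced D h̄ (oddL D (secompl f))))
corollary2p5 n p k D f sem h =
  reverseS ∘ h ,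
  LabIso-resp₂ (induced-cong D (reverseS ∘ h) (compl-evenL≗oddL-secompl sem))
               (complement-induced≃induced-complement D h (evenL D f) (evenL-bounds sem))
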